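{- There is an absolute constant $c>0$ such that the following holds. Let $w,n,k$ be positive integers, and let $h_1:[w]\to[k]$ and $h_2:[n]\to[k]$ be chosen independently and uniformly at random, defining a random $k$-bin hash $\psi$. Let $(W,T)$ be a worker/task input with $W\subseteq[w]$, $T\subseteq[n]$, $|W|=|T|\le 1.1k$, and let $(W',T')$ be the worker/task output of $\psi(W,T)$. Then $\Pr[|W'|\ge k]\le 2^{ -ck}$.
   Context: A worker/task input is a pair $(W,T)$ with $W\subseteq[w]$ (workers), $T\subseteq[n]$ (tasks), $|W|=|T|$. Given functions $h_1:[w]\to[k]$, $h_2:[n]\to[k]$, the $k$-bin hash $\psi$ acts on $(W,T)$ as follows: each worker $\omega\in W$ is placed in bin $h_1(\omega)$ and each task $\tau\in T$ in bin $h_2(\tau)$; for every bin $b\in[k]$ containing at least one worker of $W$ and at least one task of $T$, the smallest such worker is matched to the smallest such task. The worker/task output $(W',T')$ consists of the workers of $W$ and tasks of $T$ left unmatched (so $|W'|=|T'|$). -}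

module Defs where

open import Data.Nat using (ℕ; zero; suc; _≡ᵇ_; _<ᵇ_; _≤ᵇ_)
open import Data.Bool using (Bool; true; false; _∧_; _∨_; not; T)
open import Data.Fin using (Fin; toℕ)
import Data.Fin as Fin
open import Data.Fin.Subset using (Subset; ∣_∣)
open import Data.Vec using (lookup; tabulate)
open import Data.Vec.Functional as VF using ()
open import Data.List using (List; []; _∷_; map; concatMap; length; filter; cartesianProduct; allFin)
open import Data.Product using (_×_; _,_)
open import Relation.Nullary.Decidable using (T?)

anyFin : ∀ {m} → (Fin m → Bool) → Bool
anyFin {zero}  f = false
anyFin {suc m} f = f Fin.zero ∨ anyFin (λ i → f (Fin.suc i))

sameBin : ∀ {k} → Fin k → Fin k → Bool
sameBin a b = toℕ a ≡ᵇ toℕ b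

-- A worker ω is matched by the k-bin hash (h₁,h₂) iff ω ∈ W, ω is the
-- smallest worker of W in bin h₁ ω, and bin h₁ ω contains some task of T.
workerMatched : ∀ {w n k} → Subset w → Subset n →
                (Fin w → Fin k) → (Fin n → Fin k) → Fin w → Bool
workerMatched W Tk h₁ h₂ ω =
  lookup W ω
  ∧ not (anyFin (λ ω' → lookup W ω' ∧ (toℕ ω' <ᵇ toℕ ω) ∧ sameBin (h₁ ω') (h₁ ω)))
  ∧ anyFin (λ τ → lookup Tk τ ∧ sameBin (h₂ τ) (h₁ ω))

taskMatched : ∀ {w n k} → Subset w → Subset n →
              (Fin w → Fin k) → (Fin n → Fin k) → Fin n → Bool
taskMatched W Tk h₁ h₂ τ =
  lookup Tk τ
  ∧ not (anyFin (λ τ' → lookup Tk τ' ∧ (toℕ τ' <ᵇ toℕ τ) ∧ sameBin (h₂ τ') (h₂ τ)))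
  ∧ anyFin (λ ω → lookup W ω ∧ sameBin (h₁ ω) (h₂ τ))

-- Worker/task output (W', T') of ψ(W,T): the unmatched workers and tasks.
outWorkers : ∀ {w n k} → Subset w → Subset n →
             (Fin w → Fin k) → (Fin n → Fin k) → Subset w
outWorkers W Tk h₁ h₂ = tabulate (λ ω → lookup W ω ∧ not (workerMatched W Tk h₁ h₂ ω))

outTasks : ∀ {w n k} → Subset w → Subset n →
           (Fin w → Fin k) → (Fin n → Fin k) → Subset n
outTasks W Tk h₁ h₂ = tabulate (λ τ → lookup Tk τ ∧ not (taskMatched W Tk h₁ h₂ τ))

-- Enumeration of all functions Fin m → Fin k (each exactly once; k^m of them).
allFuns : ∀ m k → List (Fin m → Fin k)
allFuns zero    k = (λ ()) ∷ []
allFuns (suc m) k = concatMap (λ f → map (λ i → i VF.∷ f) (allFin k)) (allFuns m k)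

-- Number of hash pairs (h₁,h₂) (out of k^w · k^n equally likely ones)
-- for which the output satisfies |W'| ≥ k.
badCount : ∀ w n k → Subset w → Subset n → ℕ
badCount w n k W Tk =
  length (filter (λ { (h₁ , h₂) → T? (k ≤ᵇ ∣ outWorkers W Tk h₁ h₂ ∣) })
                 (cartesianProduct (allFuns w k) (allFuns n k)))

module Submission where

-- Proof strategy: a union bound over colourings of the bins.
--
-- Let m = |W| = |T|.  A hash (h₁, h₂) colours each bin "matched" (a match
-- happens in it), "idle" (it holds a worker of W but no match, hence no task
-- of T) or "workerless".  Then every worker of W lies in a bin that is not
-- workerless, every task of T in a bin that is not idle, and the s matched
-- bins carry the s matches, so |W'| ≥ k forces s + k ≤ m.  For one fixed
-- colouring with a non-workerless and c non-idle bins (a + c = k + s ≤ m) the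
-- hashes obeying these constraints number a^m k^(w-m) · c^m k^(n-m), which by
-- AM-GM is at most (m²/4k²)^m k^(w+n).  Summing over the 3^k colourings,
--   badCount · (4k²)^m ≤ 3^k (m²)^m k^(w+n),
-- and for k ≤ m ≤ 1.1k this gives badCount^8 · 2^k ≤ k^(8(w+n)), i.e. c = 1/8
-- (for m < k nothing is bad).

open import Defs
open import Data.Nat using (ℕ; zero; suc; z≤n; s≤s; _≤_; _<_; _+_; _*_; _∸_; _^_; _≤ᵇ_; _<ᵇ_; _≤?_; NonZero)
open import Data.Nat.Properties
open import Data.Nat.Solver using (module +-*-Solver)
open import Algebra.Properties.CommutativeMonoid.Sum +-0-commutativeMonoid using (sum; sum-cong-≗; ∑-distrib-+)
open import Algebra.Properties.CommutativeMonoid.Sum *-1-commutativeMonoid as Prod using () renaming (sum to prod)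
open import Data.Bool using (Bool; true; false; _∧_; _∨_; not; T; if_then_else_)
open import Data.Bool.Properties using (∧-comm)
open import Data.Fin using (Fin; toℕ; zero; suc)
open import Data.Fin.Properties using (toℕ-injective)
open import Data.Fin.Subset using (Subset; ∣_∣)
open import Data.Vec using (lookup; tabulate; []; _∷_)
open import Data.Vec.Properties using (lookup∘tabulate)
import Data.Vec.Functional as VF
open import Data.List using (List; []; _∷_; map; concatMap; length; filter; cartesianProduct; allFin; _++_)
import Data.List as List
open import Data.Product using (Σ; _×_; _,_; proj₁; proj₂; ∃)
open import Data.Unit using (tt)
open import Data.Empty using (⊥-elim)
open import Data.Sum using (inj₁; inj₂)
open import Relation.Nullary using (Dec; yes; no; does; ¬_)
open import Relation.Nullary.Decidable using (T?)
open import Relation.Binary.PropositionalEquality using (_≡_; refl; sym; trans; cong; cong₂; subst; subst₂; module ≡-Reasoning)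
open import Induction.WellFounded using (Acc; acc)
open import Data.Nat.Induction using (<-wellFounded)
open +-*-Solver using (solve; _:+_; _:*_; _:=_; con)

⟦_⟧ : Bool → ℕ
⟦ true ⟧ = 1
⟦ false ⟧ = 0

count : ∀ {m} → (Fin m → Bool) → ℕ
count f = sum (λ i → ⟦ f i ⟧)

count-cong : ∀ {m} {f g : Fin m → Bool} → (∀ i → f i ≡ g i) → count f ≡ count g
count-cong f≗g = sum-cong-≗ (λ i → cong ⟦_⟧ (f≗g i))

count-true : ∀ m → count {m} (λ _ → true) ≡ m
count-true zero = refl
count-true (suc m) = cong suc (count-true m)

count-false : ∀ m → count {m} (λ _ → false) ≡ 0
count-false zero = refl
count-false (suc m) = count-false m

sum-mono-≤ : ∀ {m} {f g : Fin m → ℕ} → (∀ i → f i ≤ g i) → sum f ≤ sum g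
sum-mono-≤ {zero} f≤g = z≤n
sum-mono-≤ {suc m} f≤g = +-mono-≤ (f≤g zero) (sum-mono-≤ (λ i → f≤g (suc i)))

count-∨ : ∀ {m} (f g : Fin m → Bool) → count (λ i → f i ∨ g i) ≤ count f + count g
count-∨ f g = ≤-trans (sum-mono-≤ (λ i → ⟦∨⟧ (f i) (g i))) (≤-reflexive (∑-distrib-+ (λ i → ⟦ f i ⟧) (λ i → ⟦ g i ⟧)))
  where
  ⟦∨⟧ : ∀ a b → ⟦ a ∨ b ⟧ ≤ ⟦ a ⟧ + ⟦ b ⟧
  ⟦∨⟧ true  b = s≤s z≤n
  ⟦∨⟧ false b = ≤-refl

count-split : ∀ {m} (f g : Fin m → Bool) → (∀ i → T (g i) → T (f i)) →
  count f ≡ count (λ i → f i ∧ not (g i)) + count g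
count-split f g g⇒f = trans (sum-cong-≗ (λ i → ⟦split⟧ (f i) (g i) (g⇒f i)))
  (∑-distrib-+ (λ i → ⟦ f i ∧ not (g i) ⟧) (λ i → ⟦ g i ⟧))
  where
  ⟦split⟧ : ∀ a b → (T b → T a) → ⟦ a ⟧ ≡ ⟦ a ∧ not b ⟧ + ⟦ b ⟧
  ⟦split⟧ true  true  _ = refl
  ⟦split⟧ true  false _ = refl
  ⟦split⟧ false false _ = refl
  ⟦split⟧ false true  b⇒a = ⊥-elim (b⇒a tt)

∣∣≡count : ∀ {m} (v : Subset m) → ∣ v ∣ ≡ count (lookup v)
∣∣≡count [] = refl
∣∣≡count (true ∷ v) = cong suc (∣∣≡count v)
∣∣≡count (false ∷ v) = ∣∣≡count v

∣tabulate∣≡count : ∀ {m} (f : Fin m → Bool) → ∣ tabulate f ∣ ≡ count f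
∣tabulate∣≡count f = trans (∣∣≡count (tabulate f)) (count-cong (lookup∘tabulate f))

T-∧ : ∀ {a b} → T (a ∧ b) → T a × T b
T-∧ {true} t = tt , t

∧-T : ∀ {a b} → T a → T b → T (a ∧ b)
∧-T {true} _ t = t

∧-not-T : ∀ {a b c} → T a → ¬ T b → T c → T (a ∧ not b ∧ c)
∧-not-T {true} {true}  _ ¬b _ = ⊥-elim (¬b tt)
∧-not-T {true} {false} _ _  c = c

anyFin-intro : ∀ {m} (f : Fin m → Bool) i → T (f i) → T (anyFin f)
anyFin-intro f zero t with f zero
... | true = tt
anyFin-intro f (suc i) t with f zero
... | true  = tt
... | false = anyFin-intro (λ j → f (suc j)) i t

anyFin-elim : ∀ {m} (f : Fin m → Bool) → T (anyFin f) → ∃ λ i → T (f i)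
anyFin-elim {suc m} f t with f zero in eq
... | true  = zero , subst T (sym eq) tt
... | false with anyFin-elim (λ j → f (suc j)) t
...   | i , fi = suc i , fi

allB : ∀ {m} → (Fin m → Bool) → Bool
allB {zero} f = true
allB {suc m} f = f zero ∧ allB (λ i → f (suc i))

allB-intro : ∀ {m} (f : Fin m → Bool) → (∀ i → T (f i)) → T (allB f)
allB-intro {zero} f all = tt
allB-intro {suc m} f all = ∧-T (all zero) (allB-intro (λ j → f (suc j)) (λ j → all (suc j)))

allB-cong : ∀ {m} {f g : Fin m → Bool} → (∀ i → f i ≡ g i) → allB f ≡ allB g
allB-cong {zero} f≗g = refl
allB-cong {suc m} f≗g = cong₂ _∧_ (f≗g zero) (allB-cong (λ i → f≗g (suc i)))

countL : ∀ {A : Set} → (A → Bool) → List A → ℕ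
countL p [] = 0
countL p (x ∷ xs) = ⟦ p x ⟧ + countL p xs

countL-cong : ∀ {A : Set} {p q : A → Bool} → (∀ x → p x ≡ q x) → ∀ xs → countL p xs ≡ countL q xs
countL-cong p≗q [] = refl
countL-cong p≗q (x ∷ xs) = cong₂ _+_ (cong ⟦_⟧ (p≗q x)) (countL-cong p≗q xs)

countL-false : ∀ {A : Set} (xs : List A) → countL (λ _ → false) xs ≡ 0
countL-false [] = refl
countL-false (x ∷ xs) = countL-false xs

length-filter : ∀ {A : Set} {P : A → Set} (P? : (x : A) → Dec (P x)) xs →
  length (filter P? xs) ≡ countL (λ x → does (P? x)) xs
length-filter P? [] = refl
length-filter P? (x ∷ xs) with does (P? x)
... | true  = cong suc (length-filter P? xs)
... | false = length-filter P? xs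

countL-++ : ∀ {A : Set} (p : A → Bool) xs ys → countL p (xs ++ ys) ≡ countL p xs + countL p ys
countL-++ p [] ys = refl
countL-++ p (x ∷ xs) ys = trans (cong (⟦ p x ⟧ +_) (countL-++ p xs ys)) (sym (+-assoc ⟦ p x ⟧ _ _))

countL-map : ∀ {A B : Set} (p : B → Bool) (f : A → B) xs → countL p (map f xs) ≡ countL (λ x → p (f x)) xs
countL-map p f [] = refl
countL-map p f (x ∷ xs) = cong (⟦ p (f x) ⟧ +_) (countL-map p f xs)

countL-tabulate : ∀ {A : Set} {m} (p : A → Bool) (f : Fin m → A) → countL p (List.tabulate f) ≡ count (λ i → p (f i))
countL-tabulate {m = zero} p f = refl
countL-tabulate {m = suc m} p f = cong (⟦ p (f zero) ⟧ +_) (countL-tabulate p (λ i → f (suc i)))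

countL-const∧ : ∀ {A : Set} b (p : A → Bool) xs → countL (λ x → b ∧ p x) xs ≡ ⟦ b ⟧ * countL p xs
countL-const∧ true  p xs = sym (+-identityʳ _)
countL-const∧ false p xs = countL-false xs

countL-cartesianProduct : ∀ {A B : Set} (p : A → Bool) (q : B → Bool) xs ys →
  countL (λ z → p (proj₁ z) ∧ q (proj₂ z)) (cartesianProduct xs ys) ≡ countL p xs * countL q ys
countL-cartesianProduct p q [] ys = refl
countL-cartesianProduct p q (x ∷ xs) ys = begin
    countL r (map (x ,_) ys ++ cartesianProduct xs ys)
  ≡⟨ countL-++ r (map (x ,_) ys) _ ⟩
    countL r (map (x ,_) ys) + countL r (cartesianProduct xs ys)
  ≡⟨ cong₂ _+_ (trans (countL-map r (x ,_) ys) (countL-const∧ (p x) q ys)) (countL-cartesianProduct p q xs ys) ⟩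
    ⟦ p x ⟧ * countL q ys + countL p xs * countL q ys
  ≡⟨ sym (*-distribʳ-+ (countL q ys) ⟦ p x ⟧ (countL p xs)) ⟩
    (⟦ p x ⟧ + countL p xs) * countL q ys
  ∎
  where
  open ≡-Reasoning
  r : _ → Bool
  r z = p (proj₁ z) ∧ q (proj₂ z)

countL-allFuns : ∀ m k (R : Fin m → Fin k → Bool) →
  countL (λ f → allB (λ i → R i (f i))) (allFuns m k) ≡ prod (λ i → count (R i))
countL-allFuns zero k R = refl
countL-allFuns (suc m) k R = begin
    countL P (concatMap extend (allFuns m k))
  ≡⟨ countL-extend (allFuns m k) ⟩
    countL Q (allFuns m k) * count (R zero)
  ≡⟨ cong (_* count (R zero)) (countL-allFuns m k (λ i → R (suc i))) ⟩
    prod (λ i → count (R (suc i))) * count (R zero)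
  ≡⟨ *-comm _ (count (R zero)) ⟩
    prod (λ i → count (R i))
  ∎
  where
  open ≡-Reasoning
  P : (Fin (suc m) → Fin k) → Bool
  P f = allB (λ i → R i (f i))
  Q : (Fin m → Fin k) → Bool
  Q g = allB (λ i → R (suc i) (g i))
  extend : (Fin m → Fin k) → List (Fin (suc m) → Fin k)
  extend g = map (λ a → a VF.∷ g) (allFin k)
  -- Extending g by each possible first value: P (a ∷ g) is R zero a ∧ Q g.
  countL-extend : ∀ gs → countL P (concatMap extend gs) ≡ countL Q gs * count (R zero)
  countL-extend [] = refl
  countL-extend (g ∷ gs) = begin
      countL P (extend g ++ concatMap extend gs)
    ≡⟨ countL-++ P (extend g) (concatMap extend gs) ⟩
      countL P (extend g) + countL P (concatMap extend gs)
    ≡⟨ cong₂ _+_ first-values (countL-extend gs) ⟩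
      ⟦ Q g ⟧ * count (R zero) + countL Q gs * count (R zero)
    ≡⟨ sym (*-distribʳ-+ (count (R zero)) ⟦ Q g ⟧ (countL Q gs)) ⟩
      countL Q (g ∷ gs) * count (R zero)
    ∎
    where
    first-values : countL P (extend g) ≡ ⟦ Q g ⟧ * count (R zero)
    first-values = begin
        countL P (extend g)
      ≡⟨ countL-map P (λ a → a VF.∷ g) (allFin k) ⟩
        countL (λ a → R zero a ∧ Q g) (allFin k)
      ≡⟨ countL-cong (λ a → ∧-comm (R zero a) (Q g)) (allFin k) ⟩
        countL (λ a → Q g ∧ R zero a) (allFin k)
      ≡⟨ countL-const∧ (Q g) (R zero) (allFin k) ⟩
        ⟦ Q g ⟧ * countL (R zero) (allFin k)
      ≡⟨ cong (⟦ Q g ⟧ *_) (countL-tabulate (R zero) (λ a → a)) ⟩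
        ⟦ Q g ⟧ * count (R zero)
      ∎

prod-select : ∀ {m} (S : Fin m → Bool) (a k : ℕ) →
  prod (λ i → if S i then a else k) * k ^ count S ≡ a ^ count S * k ^ m
prod-select {zero} S a k = refl
prod-select {suc m} S a k with S zero
... | true = begin
    a * P * (k * k ^ c)     ≡⟨ solve 4 (λ a P kc k → a :* P :* (k :* kc) := a :* (P :* kc) :* k) refl a P (k ^ c) k ⟩
    a * (P * k ^ c) * k     ≡⟨ cong (λ z → a * z * k) ih ⟩
    a * (a ^ c * k ^ m) * k ≡⟨ solve 4 (λ a ac km k → a :* (ac :* km) :* k := a :* ac :* (k :* km)) refl a (a ^ c) (k ^ m) k ⟩
    a * a ^ c * (k * k ^ m) ∎
  where
  open ≡-Reasoning
  P = prod (λ i → if S (suc i) then a else k)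
  c = count (λ i → S (suc i))
  ih : P * k ^ c ≡ a ^ c * k ^ m
  ih = prod-select (λ i → S (suc i)) a k
... | false = begin
    k * P * k ^ c       ≡⟨ solve 3 (λ P kc k → k :* P :* kc := P :* kc :* k) refl P (k ^ c) k ⟩
    P * k ^ c * k       ≡⟨ cong (_* k) ih ⟩
    a ^ c * k ^ m * k   ≡⟨ solve 3 (λ ac km k → ac :* km :* k := ac :* (k :* km)) refl (a ^ c) (k ^ m) k ⟩
    a ^ c * (k * k ^ m) ∎
  where
  open ≡-Reasoning
  P = prod (λ i → if S (suc i) then a else k)
  c = count (λ i → S (suc i))
  ih : P * k ^ c ≡ a ^ c * k ^ m
  ih = prod-select (λ i → S (suc i)) a k

Confined : ∀ {w k} → (Fin w → Bool) → (Fin k → Bool) → (Fin w → Fin k) → Bool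
Confined S A h = allB (λ i → not (S i) ∨ A (h i))

confined-intro : ∀ {w k} (S : Fin w → Bool) (A : Fin k → Bool) h → (∀ i → T (S i) → T (A (h i))) → T (Confined S A h)
confined-intro S A h S⇒A = allB-intro _ (λ i → implication (S i) (S⇒A i))
  where
  implication : ∀ s {a} → (T s → T a) → T (not s ∨ a)
  implication true  s⇒a = s⇒a tt
  implication false _   = tt

countL-confined : ∀ w k (S : Fin w → Bool) (A : Fin k → Bool) →
  countL (Confined S A) (allFuns w k) * k ^ count S ≡ count A ^ count S * k ^ w
countL-confined w k S A = begin
    countL (Confined S A) (allFuns w k) * k ^ count S
  ≡⟨ cong (_* k ^ count S) (countL-allFuns w k (λ i b → not (S i) ∨ A b)) ⟩
    prod (λ i → count (λ b → not (S i) ∨ A b)) * k ^ count S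
  ≡⟨ cong (_* k ^ count S) (Prod.sum-cong-≗ (λ i → choices (S i))) ⟩
    prod (λ i → if S i then count A else k) * k ^ count S
  ≡⟨ prod-select S (count A) k ⟩
    count A ^ count S * k ^ w
  ∎
  where
  open ≡-Reasoning
  choices : ∀ s → count (λ b → not s ∨ A b) ≡ (if s then count A else k)
  choices true  = refl
  choices false = count-true k

term≤sum : ∀ {m} (f : Fin m → ℕ) i → f i ≤ sum f
term≤sum f zero = m≤m+n (f zero) _
term≤sum f (suc i) = ≤-trans (term≤sum (λ j → f (suc j)) i) (m≤n+m _ (f zero))

sum-scaled-bound : ∀ {m} (f : Fin m → ℕ) D B → (∀ i → f i * D ≤ B) → sum f * D ≤ m * B
sum-scaled-bound {zero} f D B bound = z≤n
sum-scaled-bound {suc m} f D B bound = begin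
  (f zero + sum (λ i → f (suc i))) * D       ≡⟨ *-distribʳ-+ D (f zero) _ ⟩
  f zero * D + sum (λ i → f (suc i)) * D     ≤⟨ +-mono-≤ (bound zero) (sum-scaled-bound (λ i → f (suc i)) D B (λ i → bound (suc i))) ⟩
  B + m * B                                  ∎
  where open ≤-Reasoning

sumCol : ∀ {c} k → ((Fin k → Fin c) → ℕ) → ℕ
sumCol zero F = F (λ ())
sumCol (suc k) F = sum (λ a → sumCol k (λ L → F (a VF.∷ L)))

-- F depends only on the values of the colouring (there is no function extensionality).
Respects : ∀ {c k} → ((Fin k → Fin c) → ℕ) → Set
Respects F = ∀ L L′ → (∀ i → L i ≡ L′ i) → F L ≡ F L′

term≤sumCol : ∀ {c} k (F : (Fin k → Fin c) → ℕ) → Respects F → ∀ L → F L ≤ sumCol k F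
term≤sumCol zero F resp L = ≤-reflexive (resp L (λ ()) (λ ()))
term≤sumCol (suc k) F resp L = begin
    F L
  ≡⟨ resp L (L zero VF.∷ tail) (λ { zero → refl ; (suc i) → refl }) ⟩
    F (L zero VF.∷ tail)
  ≤⟨ term≤sumCol k (λ L′ → F (L zero VF.∷ L′)) (λ L₁ L₂ eq → resp _ _ (λ { zero → refl ; (suc i) → eq i })) tail ⟩
    sumCol k (λ L′ → F (L zero VF.∷ L′))
  ≤⟨ term≤sum (λ a → sumCol k (λ L′ → F (a VF.∷ L′))) (L zero) ⟩
    sumCol (suc k) F
  ∎
  where
  open ≤-Reasoning
  tail : Fin k → _
  tail i = L (suc i)

sumCol-+ : ∀ {c} k (F G : (Fin k → Fin c) → ℕ) → sumCol k (λ L → F L + G L) ≡ sumCol k F + sumCol k G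
sumCol-+ zero F G = refl
sumCol-+ (suc k) F G = trans (sum-cong-≗ (λ a → sumCol-+ k (λ L → F (a VF.∷ L)) (λ L → G (a VF.∷ L))))
  (∑-distrib-+ (λ a → sumCol k (λ L → F (a VF.∷ L))) (λ a → sumCol k (λ L → G (a VF.∷ L))))

sumCol-bound : ∀ {c} k (F : (Fin k → Fin c) → ℕ) D B → (∀ L → F L * D ≤ B) → sumCol k F * D ≤ c ^ k * B
sumCol-bound zero F D B bound = ≤-trans (bound _) (≤-reflexive (sym (+-identityʳ B)))
sumCol-bound {c} (suc k) F D B bound = ≤-trans
  (sum-scaled-bound (λ a → sumCol k (λ L → F (a VF.∷ L))) D (c ^ k * B) (λ a → sumCol-bound k _ D B (λ L → bound _)))
  (≤-reflexive (sym (*-assoc c (c ^ k) B)))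

countL-union : ∀ {A : Set} {c} k (P : A → Bool) (Q : (Fin k → Fin c) → A → Bool) →
  (∀ x → Respects (λ L → ⟦ Q L x ⟧)) → (∀ x → T (P x) → ∃ λ L → T (Q L x)) →
  ∀ xs → countL P xs ≤ sumCol k (λ L → countL (Q L) xs)
countL-union k P Q resp cover [] = z≤n
countL-union k P Q resp cover (x ∷ xs) = ≤-trans
  (+-mono-≤ (covered (P x) refl) (countL-union k P Q resp cover xs))
  (≤-reflexive (sym (sumCol-+ k (λ L → ⟦ Q L x ⟧) (λ L → countL (Q L) xs))))
  where
  covered : ∀ b → P x ≡ b → ⟦ b ⟧ ≤ sumCol k (λ L → ⟦ Q L x ⟧)
  covered false _ = z≤n
  covered true Px with cover x (subst T (sym Px) tt)
  ... | L , QLx = ≤-trans (one≤ (Q L x) QLx) (term≤sumCol k (λ L → ⟦ Q L x ⟧) (resp x) L)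
    where
    one≤ : ∀ b → T b → 1 ≤ ⟦ b ⟧
    one≤ true _ = s≤s z≤n

sameBin⇒≡ : ∀ {k} {a b : Fin k} → T (sameBin a b) → a ≡ b
sameBin⇒≡ {a = a} {b} t = toℕ-injective (≡ᵇ⇒≡ (toℕ a) (toℕ b) t)

≡⇒sameBin : ∀ {k} {a b : Fin k} → a ≡ b → T (sameBin a b)
≡⇒sameBin {a = a} refl = ≡⇒≡ᵇ (toℕ a) (toℕ a) refl

count-sameBin : ∀ {k} (a : Fin k) → count (sameBin a) ≤ 1
count-sameBin {suc k} zero = ≤-reflexive (cong suc (count-false k))
count-sameBin {suc k} (suc a) = count-sameBin a

receives : ∀ {w k} → (Fin w → Bool) → (Fin w → Fin k) → Fin k → Bool
receives M h b = anyFin (λ i → M i ∧ sameBin (h i) b)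

receives-intro : ∀ {w k} (M : Fin w → Bool) (h : Fin w → Fin k) i → T (M i) → T (receives M h (h i))
receives-intro M h i Mi = anyFin-intro (λ j → M j ∧ sameBin (h j) (h i)) i (∧-T Mi (≡⇒sameBin {a = h i} refl))

count-receives : ∀ {w k} (M : Fin w → Bool) (h : Fin w → Fin k) → count (receives M h) ≤ count M
count-receives {zero} {k} M h = ≤-reflexive (count-false k)
count-receives {suc w} {k} M h = ≤-trans
  (count-∨ (λ b → M zero ∧ sameBin (h zero) b) (receives (λ i → M (suc i)) (λ i → h (suc i))))
  (+-mono-≤ (first (M zero)) (count-receives (λ i → M (suc i)) (λ i → h (suc i))))
  where
  first : ∀ m₀ → count (λ b → m₀ ∧ sameBin (h zero) b) ≤ ⟦ m₀ ⟧
  first true  = count-sameBin (h zero)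
  first false = ≤-reflexive (count-false k)

pattern matchedBin    = zero
pattern idleBin       = suc zero
pattern workerlessBin = suc (suc zero)

isMatchedBin notIdle notWorkerless : Fin 3 → Bool
isMatchedBin matchedBin = true
isMatchedBin _          = false
notIdle idleBin = false
notIdle _       = true
notWorkerless workerlessBin = false
notWorkerless _             = true

colour-count : ∀ {k} (L : Fin k → Fin 3) →
  count (λ b → notWorkerless (L b)) + count (λ b → notIdle (L b)) ≡ k + count (λ b → isMatchedBin (L b))
colour-count {k} L = begin
    count (λ b → notWorkerless (L b)) + count (λ b → notIdle (L b))
  ≡⟨ sym (∑-distrib-+ (λ b → ⟦ notWorkerless (L b) ⟧) (λ b → ⟦ notIdle (L b) ⟧)) ⟩
    sum (λ b → ⟦ notWorkerless (L b) ⟧ + ⟦ notIdle (L b) ⟧)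
  ≡⟨ sum-cong-≗ (λ b → per-bin (L b)) ⟩
    sum (λ b → 1 + ⟦ isMatchedBin (L b) ⟧)
  ≡⟨ ∑-distrib-+ (λ _ → 1) (λ b → ⟦ isMatchedBin (L b) ⟧) ⟩
    count {k} (λ _ → true) + count (λ b → isMatchedBin (L b))
  ≡⟨ cong (_+ count (λ b → isMatchedBin (L b))) (count-true k) ⟩
    k + count (λ b → isMatchedBin (L b))
  ∎
  where
  open ≡-Reasoning
  per-bin : ∀ c → ⟦ notWorkerless c ⟧ + ⟦ notIdle c ⟧ ≡ 1 + ⟦ isMatchedBin c ⟧
  per-bin matchedBin    = refl
  per-bin idleBin       = refl
  per-bin workerlessBin = refl

colourOf : Bool → Bool → Fin 3
colourOf hasMatch hasWorker = if hasMatch then matchedBin else (if hasWorker then idleBin else workerlessBin)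

isMatchedBin-colourOf : ∀ x y → isMatchedBin (colourOf x y) ≡ x
isMatchedBin-colourOf true  y     = refl
isMatchedBin-colourOf false true  = refl
isMatchedBin-colourOf false false = refl

notWorkerless-colourOf : ∀ x y → T y → T (notWorkerless (colourOf x y))
notWorkerless-colourOf true  y    _ = tt
notWorkerless-colourOf false true _ = tt

notIdle-colourOf : ∀ x y → (T y → T x) → T (notIdle (colourOf x y))
notIdle-colourOf true  y     _   = tt
notIdle-colourOf false true  y⇒x = ⊥-elim (y⇒x tt)
notIdle-colourOf false false _   = tt

Consistent : ∀ {w n k} → ℕ → Subset w → Subset n → (Fin k → Fin 3) → (Fin w → Fin k) × (Fin n → Fin k) → Bool
Consistent {k = k} m W Tk L hs =
  ((count (λ b → isMatchedBin (L b)) + k ≤ᵇ m) ∧ Confined (lookup W) (λ b → notWorkerless (L b)) (proj₁ hs))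
  ∧ Confined (lookup Tk) (λ b → notIdle (L b)) (proj₂ hs)

module Hash {w n k} (W : Subset w) (Tk : Subset n) (h₁ : Fin w → Fin k) (h₂ : Fin n → Fin k) where

  matched : Fin w → Bool
  matched = workerMatched W Tk h₁ h₂

  -- A bin holding a worker of W and a task of T holds a matched worker, namely
  -- its smallest worker (found by well-founded descent on worker indices).
  matched-in-bin : ∀ ω → Acc _<_ (toℕ ω) → T (lookup W ω) →
    T (receives (lookup Tk) h₂ (h₁ ω)) → T (receives matched h₁ (h₁ ω))
  matched-in-bin ω (acc descend) ω∈W task
    with T? (anyFin (λ ω′ → lookup W ω′ ∧ (toℕ ω′ <ᵇ toℕ ω) ∧ sameBin (h₁ ω′) (h₁ ω)))
  ... | no no-smaller = receives-intro matched h₁ ω (∧-not-T ω∈W no-smaller task)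
  ... | yes smaller with anyFin-elim _ smaller
  ...   | ω′ , t with T-∧ {lookup W ω′} t
  ...     | ω′∈W , t′ with T-∧ {toℕ ω′ <ᵇ toℕ ω} t′
  ...       | ω′<ω , same = subst (λ b → T (receives matched h₁ b)) bin-eq
    (matched-in-bin ω′ (descend (<ᵇ⇒< (toℕ ω′) (toℕ ω) ω′<ω)) ω′∈W
      (subst (λ b → T (receives (lookup Tk) h₂ b)) (sym bin-eq) task))
    where
    bin-eq : h₁ ω′ ≡ h₁ ω
    bin-eq = sameBin⇒≡ same

  colouring : Fin k → Fin 3
  colouring b = colourOf (receives matched h₁ b) (receives (lookup W) h₁ b)

  workers-placed : T (Confined (lookup W) (λ b → notWorkerless (colouring b)) h₁)
  workers-placed = confined-intro (lookup W) (λ b → notWorkerless (colouring b)) h₁ (λ ω ω∈W →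
    notWorkerless-colourOf (receives matched h₁ (h₁ ω)) _ (receives-intro (lookup W) h₁ ω ω∈W))

  -- A bin receiving a task and a worker has a match, so no task lies in an idle bin.
  tasks-placed : T (Confined (lookup Tk) (λ b → notIdle (colouring b)) h₂)
  tasks-placed = confined-intro (lookup Tk) (λ b → notIdle (colouring b)) h₂ (λ τ τ∈T →
    notIdle-colourOf (receives matched h₁ (h₂ τ)) (receives (lookup W) h₁ (h₂ τ)) (has-match τ τ∈T))
    where
    has-match : ∀ τ → T (lookup Tk τ) → T (receives (lookup W) h₁ (h₂ τ)) → T (receives matched h₁ (h₂ τ))
    has-match τ τ∈T has-worker with anyFin-elim _ has-worker
    ... | ω , t with T-∧ {lookup W ω} t
    ...   | ω∈W , same = subst (λ b → T (receives matched h₁ b)) bin-eq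
      (matched-in-bin ω (<-wellFounded (toℕ ω)) ω∈W
        (subst (λ b → T (receives (lookup Tk) h₂ b)) (sym bin-eq) (receives-intro (lookup Tk) h₂ τ τ∈T)))
      where
      bin-eq : h₁ ω ≡ h₂ τ
      bin-eq = sameBin⇒≡ same

  size-W : count (lookup W) ≡ ∣ outWorkers W Tk h₁ h₂ ∣ + count matched
  size-W = trans (count-split (lookup W) matched (λ ω t → proj₁ (T-∧ {lookup W ω} t)))
    (cong (_+ count matched) (sym (∣tabulate∣≡count (λ ω → lookup W ω ∧ not (matched ω)))))

  matched-bins : k ≤ ∣ outWorkers W Tk h₁ h₂ ∣ → count (λ b → isMatchedBin (colouring b)) + k ≤ count (lookup W)
  matched-bins k≤out = begin
      count (λ b → isMatchedBin (colouring b)) + k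
    ≡⟨ cong (_+ k) (count-cong (λ b → isMatchedBin-colourOf (receives matched h₁ b) _)) ⟩
      count (receives matched h₁) + k
    ≤⟨ +-mono-≤ (count-receives matched h₁) k≤out ⟩
      count matched + ∣ outWorkers W Tk h₁ h₂ ∣
    ≡⟨ +-comm (count matched) _ ⟩
      ∣ outWorkers W Tk h₁ h₂ ∣ + count matched
    ≡⟨ sym size-W ⟩
      count (lookup W)
    ∎
    where open ≤-Reasoning

  consistent : k ≤ ∣ outWorkers W Tk h₁ h₂ ∣ → T (Consistent (count (lookup W)) W Tk colouring (h₁ , h₂))
  consistent k≤out = ∧-T (∧-T (≤⇒≤ᵇ (matched-bins k≤out)) workers-placed) tasks-placed

^-distribʳ-* : ∀ a b n → (a * b) ^ n ≡ a ^ n * b ^ n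
^-distribʳ-* a b zero = refl
^-distribʳ-* a b (suc n) = trans (cong (a * b *_) (^-distribʳ-* a b n))
  (solve 4 (λ a b x y → a :* b :* (x :* y) := a :* x :* (b :* y)) refl a b (a ^ n) (b ^ n))

^-swap : ∀ x a b → (x ^ a) ^ b ≡ (x ^ b) ^ a
^-swap x a b = trans (^-*-assoc x a b) (trans (cong (x ^_) (*-comm a b)) (sym (^-*-assoc x b a)))

-- AM-GM for two naturals, when a ≤ c: writing c = a + d, (a + c)² = 4ac + d².
am-gm-ordered : ∀ {a c} → a ≤ c → 4 * a * c ≤ (a + c) * (a + c)
am-gm-ordered {a} {c} a≤c = subst (λ c → 4 * a * c ≤ (a + c) * (a + c)) (m+[n∸m]≡n a≤c) (gap (c ∸ a))
  where
  gap : ∀ d → 4 * a * (a + d) ≤ (a + (a + d)) * (a + (a + d))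
  gap d = ≤-trans (m≤m+n _ (d * d))
    (≤-reflexive (solve 2 (λ a d → con 4 :* a :* (a :+ d) :+ d :* d := (a :+ (a :+ d)) :* (a :+ (a :+ d))) refl a d))

am-gm : ∀ a c → 4 * a * c ≤ (a + c) * (a + c)
am-gm a c with ≤-total a c
... | inj₁ a≤c = am-gm-ordered a≤c
... | inj₂ c≤a = subst₂ _≤_ (solve 2 (λ a c → con 4 :* c :* a := con 4 :* a :* c) refl a c)
  (cong₂ _*_ (+-comm c a) (+-comm c a)) (am-gm-ordered c≤a)

product-bound : ∀ {N₁ N₂ a c k m M X Y} → N₁ * k ^ m ≡ a ^ m * X → N₂ * k ^ m ≡ c ^ m * Y → a + c ≤ M →
  N₁ * N₂ * (4 * k * k) ^ m ≤ (M * M) ^ m * (X * Y)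
product-bound {N₁} {N₂} {a} {c} {k} {m} {M} {X} {Y} count₁ count₂ a+c≤M = begin
    N₁ * N₂ * (4 * k * k) ^ m
  ≡⟨ cong (N₁ * N₂ *_) (trans (^-distribʳ-* (4 * k) k m) (cong (_* k ^ m) (^-distribʳ-* 4 k m))) ⟩
    N₁ * N₂ * (4 ^ m * k ^ m * k ^ m)
  ≡⟨ solve 5 (λ N₁ N₂ f km km′ → N₁ :* N₂ :* (f :* km :* km′) := N₁ :* km :* (N₂ :* km′) :* f) refl N₁ N₂ (4 ^ m) (k ^ m) (k ^ m) ⟩
    N₁ * k ^ m * (N₂ * k ^ m) * 4 ^ m
  ≡⟨ cong₂ (λ u v → u * v * 4 ^ m) count₁ count₂ ⟩
    a ^ m * X * (c ^ m * Y) * 4 ^ m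
  ≡⟨ solve 5 (λ am X cm Y f → am :* X :* (cm :* Y) :* f := f :* am :* cm :* (X :* Y)) refl (a ^ m) X (c ^ m) Y (4 ^ m) ⟩
    4 ^ m * a ^ m * c ^ m * (X * Y)
  ≡⟨ cong (_* (X * Y)) (sym (trans (^-distribʳ-* (4 * a) c m) (cong (_* c ^ m) (^-distribʳ-* 4 a m)))) ⟩
    (4 * a * c) ^ m * (X * Y)
  ≤⟨ *-monoˡ-≤ (X * Y) (^-monoˡ-≤ m (≤-trans (am-gm a c) (*-mono-≤ a+c≤M a+c≤M))) ⟩
    (M * M) ^ m * (X * Y)
  ∎
  where open ≤-Reasoning

-- c^k · a^m ≤ b^m when k ≤ m, c · a ≤ b and a ≤ b: the first k factors absorb c.
weighted-pow : ∀ {a b c k m} → k ≤ m → c * a ≤ b → a ≤ b → c ^ k * a ^ m ≤ b ^ m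
weighted-pow {a} {b} {c} {k} {m} k≤m ca≤b a≤b = subst (λ m → c ^ k * a ^ m ≤ b ^ m) (m+[n∸m]≡n k≤m) (begin
    c ^ k * a ^ (k + t)
  ≡⟨ cong (c ^ k *_) (^-distribˡ-+-* a k t) ⟩
    c ^ k * (a ^ k * a ^ t)
  ≡⟨ trans (sym (*-assoc (c ^ k) (a ^ k) (a ^ t))) (cong (_* a ^ t) (sym (^-distribʳ-* c a k))) ⟩
    (c * a) ^ k * a ^ t
  ≤⟨ *-mono-≤ (^-monoˡ-≤ k ca≤b) (^-monoˡ-≤ t a≤b) ⟩
    b ^ k * b ^ t
  ≡⟨ sym (^-distribˡ-+-* b k t) ⟩
    b ^ (k + t)
  ∎)
  where
  open ≤-Reasoning
  t = m ∸ k

square-ratio : ∀ {k m} → 10 * m ≤ 11 * k → 100 * (m * m) ≤ 121 * (k * k)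
square-ratio {k} {m} le = begin
  100 * (m * m)          ≡⟨ solve 1 (λ m → con 100 :* (m :* m) := (con 10 :* m) :* (con 10 :* m)) refl m ⟩
  (10 * m) * (10 * m)    ≤⟨ *-mono-≤ le le ⟩
  (11 * k) * (11 * k)    ≡⟨ solve 1 (λ k → (con 11 :* k) :* (con 11 :* k) := con 121 :* (k :* k)) refl k ⟩
  121 * (k * k)          ∎
  where open ≤-Reasoning

square-le : ∀ {k m} → 10 * m ≤ 11 * k → m * m ≤ 4 * k * k
square-le {k} {m} le = *-cancelˡ-≤ 100 (≤-trans (square-ratio {k} {m} le) (begin
  121 * (k * k)          ≤⟨ *-monoˡ-≤ (k * k) (≤ᵇ⇒≤ 121 400 tt) ⟩
  400 * (k * k)          ≡⟨ solve 1 (λ k → con 400 :* (k :* k) := con 100 :* (con 4 :* k :* k)) refl k ⟩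
  100 * (4 * k * k)      ∎))
  where open ≤-Reasoning

-- Since 3^8 · 2 · 1.21^8 < 4^8: 3^8 · 2 · (m²)^8 ≤ (4k²)^8.
ratio-bound : ∀ {k m} → 10 * m ≤ 11 * k → 3 ^ 8 * 2 * (m * m) ^ 8 ≤ (4 * k * k) ^ 8
ratio-bound {k} {m} le = *-cancelˡ-≤ (100 ^ 8) (begin
    100 ^ 8 * (c * (m * m) ^ 8)
  ≡⟨ solve 3 (λ h c x → h :* (c :* x) := c :* (h :* x)) refl (100 ^ 8) c ((m * m) ^ 8) ⟩
    c * (100 ^ 8 * (m * m) ^ 8)
  ≡⟨ cong (c *_) (sym (^-distribʳ-* 100 (m * m) 8)) ⟩
    c * (100 * (m * m)) ^ 8
  ≤⟨ *-monoʳ-≤ c (^-monoˡ-≤ 8 (square-ratio {k} {m} le)) ⟩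
    c * (121 * (k * k)) ^ 8
  ≡⟨ trans (cong (c *_) (^-distribʳ-* 121 (k * k) 8)) (sym (*-assoc c (121 ^ 8) ((k * k) ^ 8))) ⟩
    c * 121 ^ 8 * (k * k) ^ 8
  ≤⟨ *-monoˡ-≤ ((k * k) ^ 8) (≤ᵇ⇒≤ (c * 121 ^ 8) (100 ^ 8 * 4 ^ 8) tt) ⟩
    100 ^ 8 * 4 ^ 8 * (k * k) ^ 8
  ≡⟨ trans (*-assoc (100 ^ 8) (4 ^ 8) ((k * k) ^ 8))
       (cong (100 ^ 8 *_) (trans (sym (^-distribʳ-* 4 (k * k) 8)) (cong (_^ 8) (sym (*-assoc 4 k k))))) ⟩
    100 ^ 8 * (4 * k * k) ^ 8
  ∎)
  where
  open ≤-Reasoning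
  c = 3 ^ 8 * 2

-- The final estimate: from badCount · (4k²)^m ≤ 3^k (m²)^m K with k ≤ m ≤ 1.1k
-- it follows that badCount^8 · 2^k ≤ K^8, since 3^(8k) · 2^k · (m²)^(8m) ≤ (4k²)^(8m).
eighth-power-bound : ∀ {k m K bad} → 1 ≤ k → k ≤ m → 10 * m ≤ 11 * k →
  bad * (4 * k * k) ^ m ≤ 3 ^ k * ((m * m) ^ m * K) → bad ^ 8 * 2 ^ (1 * k) ≤ K ^ 8
eighth-power-bound {k@(suc _)} {m} {K} {bad} _ k≤m le bound = *-cancelʳ-≤ (bad ^ 8 * 2 ^ (1 * k)) (K ^ 8) (D ^ 8) {{D⁸≢0}} (begin
    bad ^ 8 * 2 ^ (1 * k) * D ^ 8
  ≡⟨ cong (λ e → bad ^ 8 * 2 ^ e * D ^ 8) (*-identityˡ k) ⟩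
    bad ^ 8 * 2 ^ k * D ^ 8
  ≡⟨ trans (solve 3 (λ b t d → b :* t :* d := b :* d :* t) refl (bad ^ 8) (2 ^ k) (D ^ 8)) (cong (_* 2 ^ k) (sym (^-distribʳ-* bad D 8))) ⟩
    (bad * D) ^ 8 * 2 ^ k
  ≤⟨ *-monoˡ-≤ (2 ^ k) (^-monoˡ-≤ 8 bound) ⟩
    (3 ^ k * (E * K)) ^ 8 * 2 ^ k
  ≡⟨ cong (_* 2 ^ k) (trans (^-distribʳ-* (3 ^ k) (E * K) 8) (cong ((3 ^ k) ^ 8 *_) (^-distribʳ-* E K 8))) ⟩
    (3 ^ k) ^ 8 * (E ^ 8 * K ^ 8) * 2 ^ k
  ≡⟨ solve 4 (λ a e x t → a :* (e :* x) :* t := x :* (a :* t :* e)) refl ((3 ^ k) ^ 8) (E ^ 8) (K ^ 8) (2 ^ k) ⟩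
    K ^ 8 * ((3 ^ k) ^ 8 * 2 ^ k * E ^ 8)
  ≡⟨ cong (K ^ 8 *_) (cong₂ _*_ (trans (cong (_* 2 ^ k) (^-swap 3 k 8)) (sym (^-distribʳ-* (3 ^ 8) 2 k))) (^-swap (m * m) m 8)) ⟩
    K ^ 8 * ((3 ^ 8 * 2) ^ k * ((m * m) ^ 8) ^ m)
  ≤⟨ *-monoʳ-≤ (K ^ 8) (weighted-pow {(m * m) ^ 8} {(4 * k * k) ^ 8} {3 ^ 8 * 2} k≤m (ratio-bound {k} {m} le) (^-monoˡ-≤ 8 (square-le {k} {m} le))) ⟩
    K ^ 8 * ((4 * k * k) ^ 8) ^ m
  ≡⟨ cong (K ^ 8 *_) (^-swap (4 * k * k) 8 m) ⟩
    K ^ 8 * D ^ 8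
  ∎)
  where
  open ≤-Reasoning
  D = (4 * k * k) ^ m
  E = (m * m) ^ m
  D⁸≢0 : NonZero (D ^ 8)
  D⁸≢0 = m^n≢0 D 8 {{m^n≢0 (4 * k * k) m}}

hashes : ∀ w n k → List ((Fin w → Fin k) × (Fin n → Fin k))
hashes w n k = cartesianProduct (allFuns w k) (allFuns n k)

Consistent-resp : ∀ {w n k} m (W : Subset w) (Tk : Subset n) hs {L L′ : Fin k → Fin 3} →
  (∀ b → L b ≡ L′ b) → Consistent m W Tk L hs ≡ Consistent m W Tk L′ hs
Consistent-resp m W Tk hs L≗L′ = cong₂ _∧_
  (cong₂ _∧_ (cong (λ s → s + _ ≤ᵇ m) (count-cong (λ b → cong isMatchedBin (L≗L′ b))))
             (allB-cong (λ ω → cong (λ c → not (lookup W ω) ∨ notWorkerless c) (L≗L′ _))))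
  (allB-cong (λ τ → cong (λ c → not (lookup Tk τ) ∨ notIdle c) (L≗L′ _)))

-- For a fixed colouring L with s matched bins, a bins that are not workerless and c
-- that are not idle, the consistent hashes number [s + k ≤ m] · N₁ · N₂ with
-- N₁ · k^m = a^m k^w and N₂ · k^m = c^m k^n; as a + c = k + s ≤ m, AM-GM bounds this.
consistent-bound : ∀ {w n k} (W : Subset w) (Tk : Subset n) → count (lookup Tk) ≡ count (lookup W) →
  ∀ L → let m = count (lookup W) in
  countL (Consistent m W Tk L) (hashes w n k) * (4 * k * k) ^ m ≤ (m * m) ^ m * k ^ (w + n)
consistent-bound {w} {n} {k} W Tk sizes L =
  ≤-trans (≤-reflexive (cong (_* D) split)) (bounded (s + k ≤ᵇ m) (≤ᵇ⇒≤ (s + k) m))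
  where
  m s a c N₁ N₂ D : ℕ
  m = count (lookup W)
  s = count (λ b → isMatchedBin (L b))
  a = count (λ b → notWorkerless (L b))
  c = count (λ b → notIdle (L b))
  N₁ = countL (Confined (lookup W) (λ b → notWorkerless (L b))) (allFuns w k)
  N₂ = countL (Confined (lookup Tk) (λ b → notIdle (L b))) (allFuns n k)
  D = (4 * k * k) ^ m

  split : countL (Consistent m W Tk L) (hashes w n k) ≡ ⟦ s + k ≤ᵇ m ⟧ * N₁ * N₂
  split = trans (countL-cartesianProduct _ _ (allFuns w k) (allFuns n k))
    (cong (_* N₂) (countL-const∧ (s + k ≤ᵇ m) _ (allFuns w k)))

  count₁ : N₁ * k ^ m ≡ a ^ m * k ^ w
  count₁ = countL-confined w k (lookup W) (λ b → notWorkerless (L b))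

  count₂ : N₂ * k ^ m ≡ c ^ m * k ^ n
  count₂ = subst (λ t → N₂ * k ^ t ≡ c ^ t * k ^ n) sizes (countL-confined n k (lookup Tk) (λ b → notIdle (L b)))

  bounded : ∀ few → (T few → s + k ≤ m) → ⟦ few ⟧ * N₁ * N₂ * D ≤ (m * m) ^ m * k ^ (w + n)
  bounded false _ = z≤n
  bounded true few = begin
    (N₁ + 0) * N₂ * D             ≡⟨ cong (λ x → x * N₂ * D) (+-identityʳ N₁) ⟩
    N₁ * N₂ * D                   ≤⟨ product-bound {N₁} {N₂} {a} {c} {k} {m} {m} {k ^ w} {k ^ n} count₁ count₂ a+c≤m ⟩
    (m * m) ^ m * (k ^ w * k ^ n) ≡⟨ cong ((m * m) ^ m *_) (sym (^-distribˡ-+-* k w n)) ⟩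
    (m * m) ^ m * k ^ (w + n)     ∎
    where
    open ≤-Reasoning
    a+c≤m : a + c ≤ m
    a+c≤m = ≤-trans (≤-reflexive (trans (colour-count L) (+-comm k s))) (few tt)

-- Union bound over the 3^k colourings: every bad hash is consistent with its own colouring.
badCount-bound : ∀ {w n k} (W : Subset w) (Tk : Subset n) → count (lookup Tk) ≡ count (lookup W) →
  let m = count (lookup W) in
  badCount w n k W Tk * (4 * k * k) ^ m ≤ 3 ^ k * ((m * m) ^ m * k ^ (w + n))
badCount-bound {w} {n} {k} W Tk sizes = ≤-trans
  (*-monoˡ-≤ ((4 * k * k) ^ m) (≤-trans (≤-reflexive (length-filter _ (hashes w n k)))
    (countL-union k _ (Consistent m W Tk) (λ hs L L′ L≗L′ → cong ⟦_⟧ (Consistent-resp m W Tk hs L≗L′)) cover (hashes w n k))))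
  (sumCol-bound k _ ((4 * k * k) ^ m) _ (consistent-bound W Tk sizes))
  where
  m = count (lookup W)
  cover : ∀ hs → T (k ≤ᵇ ∣ outWorkers W Tk (proj₁ hs) (proj₂ hs) ∣) → ∃ λ L → T (Consistent m W Tk L hs)
  cover (h₁ , h₂) bad = colouring , consistent (≤ᵇ⇒≤ k _ bad)
    where open Hash W Tk h₁ h₂

badCount-vanishes : ∀ {w n k} (W : Subset w) (Tk : Subset n) → count (lookup W) < k → badCount w n k W Tk ≡ 0
badCount-vanishes {w} {n} {k} W Tk small = trans (length-filter _ (hashes w n k)) (countL-none (hashes w n k))
  where
  never-bad : ∀ hs → ¬ T (k ≤ᵇ ∣ outWorkers W Tk (proj₁ hs) (proj₂ hs) ∣)
  never-bad (h₁ , h₂) bad = <⇒≱ small (≤-trans (≤ᵇ⇒≤ k _ bad) (≤-trans (m≤m+n _ _) (≤-reflexive (sym size-W))))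
    where open Hash W Tk h₁ h₂
  countL-none : ∀ xs → countL (λ hs → k ≤ᵇ ∣ outWorkers W Tk (proj₁ hs) (proj₂ hs) ∣) xs ≡ 0
  countL-none [] = refl
  countL-none (hs ∷ xs) with k ≤ᵇ ∣ outWorkers W Tk (proj₁ hs) (proj₂ hs) ∣ in eq
  ... | true  = ⊥-elim (never-bad hs (subst T (sym eq) tt))
  ... | false = countL-none xs

badCount-estimate : ∀ w n k → 1 ≤ k → (W : Subset w) (Tk : Subset n) → count (lookup Tk) ≡ count (lookup W) →
  10 * count (lookup W) ≤ 11 * k → badCount w n k W Tk ^ 8 * 2 ^ (1 * k) ≤ (k ^ (w + n)) ^ 8
badCount-estimate w n k 1≤k W Tk sizes small with k ≤? count (lookup W)
... | yes k≤m = eighth-power-bound {K = k ^ (w + n)} {bad = badCount w n k W Tk} 1≤k k≤m small (badCount-bound W Tk sizes)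
... | no  k≰m rewrite badCount-vanishes {w} {n} {k} W Tk (≰⇒> k≰m) = z≤n

lemma7 : Σ ℕ λ p → Σ ℕ λ q → 1 ≤ p × 1 ≤ q ×
    ((w n k : ℕ) → 1 ≤ w → 1 ≤ n → 1 ≤ k →
    (W : Subset w) (Tk : Subset n) →
    ∣ W ∣ ≡ ∣ Tk ∣ → 10 * ∣ W ∣ ≤ 11 * k →
    badCount w n k W Tk ^ q * 2 ^ (p * k) ≤ (k ^ (w + n)) ^ q)
lemma7 = 1 , 8 , s≤s z≤n , s≤s z≤n , λ w n k _ _ 1≤k W Tk same-size small →
  badCount-estimate w n k 1≤k W Tk
    (trans (sym (∣∣≡count Tk)) (trans (sym same-size) (∣∣≡count W)))
    (subst (λ x → 10 * x ≤ 11 * k) (∣∣≡count W) small)
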